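{- Let $W=\{n \in \mathbb{N}: \text{for every prime } p,\ p\mid n \Rightarrow p^2\mid n\}$ be the set of powerful numbers. Assume either the $abc$ conjecture or the Schinzel–Tijdeman conjecture. Then there is no infinite Hilbert cube contained in $W$; that is, there do not exist a non-negative integer $a_0$ and an infinite sequence of positive integers $a_1,a_2,\ldots$ with $H(a_0;a_1,a_2,\ldots)\subset W$.
   Context: For an integer $a_0$ and an infinite sequence $a_1,a_2,\dots$, $H(a_0;a_1,a_2,\dots)=\{a_0+\sum_{i\ge 1}\varepsilon_i a_i : \varepsilon_i\in\{0,1\},\ \text{only finitely many } \varepsilon_i \ne 0\}$ when $a_0\neq0$; when $a_0=0$ the empty sum is excluded. The $abc$ conjecture: for every $\varepsilon>0$ there is $C_\varepsilon$ such that whenever $a+b=c$ for non-zero integers $a,b,c$ with $\gcd(a,b,c)=1$, one has $\max\{|a|,|b|,|c|\}\le C_\varepsilon P^{1+\varepsilon}$ where $P=\prod_{p\mid abc}p$ (product over primes). The Schinzel–Tijdeman conjecture: if a polynomial $P$ with rational coefficients has at least three simple zeros, then the equation $y^2z^3=P(x)$ has only finitely many solutions in integers $x,y,z$ with $yz\ne 0$. -}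

module Defs where

open import Level using (0ℓ)
open import Data.Bool using (Bool; true; false; if_then_else_)
open import Data.Nat as ℕ using (ℕ; zero; suc; _≤_; _<_; _⊔_; _^_)
open import Data.Nat.Divisibility using (_∣_; _∣?_)
open import Data.Nat.Primality using (Prime; prime?)
open import Data.Nat.GCD using (gcd)
open import Data.Integer as ℤ using (ℤ; ∣_∣)
open import Data.Rational as ℚ using (ℚ)
open import Data.List using (List; []; _∷_; filter; upTo; foldr)
open import Data.Nat.ListAction using (product)
open import Data.Product using (Σ; ∃; _×_; _,_)
open import Data.Sum using (_⊎_)
open import Relation.Nullary using (¬_)
open import Relation.Nullary.Decidable using (_×-dec_)
open import Relation.Binary.PropositionalEquality using (_≡_)
open import Algebra.Bundles using (CommutativeRing)

Powerful : ℕ → Set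
Powerful n = (p : ℕ) → Prime p → p ∣ n → p ^ 2 ∣ n

-- The sequence a₁, a₂, … is represented by
-- a : ℕ → ℕ with  a i = a_{i+1}.  A finitely supported 0/1 choice
-- (ε_i) is represented by a length n and ε : ℕ → Bool, using only
-- the indices i < n.

selSum : (ℕ → ℕ) → (ℕ → Bool) → ℕ → ℕ
selSum a ε zero    = 0
selSum a ε (suc n) = selSum a ε n ℕ.+ (if ε n then a n else 0)

NonEmptySel : (ℕ → Bool) → ℕ → Set
NonEmptySel ε n = ∃ λ i → i < n × ε i ≡ true

-- x ∈ H(a₀; a₁, a₂, …); when a₀ = 0 the empty sum is excluded
InHilbertCube : ℕ → (ℕ → ℕ) → ℕ → Set
InHilbertCube a₀ a x =
  Σ ℕ λ n → Σ (ℕ → Bool) λ ε →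
    (¬ a₀ ≡ 0 ⊎ NonEmptySel ε n) × x ≡ a₀ ℕ.+ selSum a ε n

rad : ℕ → ℕ
rad n = product (filter (λ p → prime? p ×-dec p ∣? n) (upTo (suc n)))

-- ε > 0 is taken rational, ε = e / q with e, q ≥ 1, and the real constant
-- C_ε is replaced by a natural number K (= ⌈C_ε⌉^q):
--   max ≤ C P^{1+e/q}  ⇔  max^q ≤ C^q P^{q+e}.
ABC : Set
ABC = (e q : ℕ) → 1 ≤ e → 1 ≤ q → ∃ λ (K : ℕ) →
  (a b c : ℤ) → ¬ a ≡ ℤ.0ℤ → ¬ b ≡ ℤ.0ℤ → ¬ c ≡ ℤ.0ℤ →
  a ℤ.+ b ≡ c → gcd (gcd ∣ a ∣ ∣ b ∣) ∣ c ∣ ≡ 1 →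
  (∣ a ∣ ⊔ ∣ b ∣ ⊔ ∣ c ∣) ^ q ≤ K ℕ.* rad ∣ a ℤ.* b ℤ.* c ∣ ^ (q ℕ.+ e)

-- Polynomials with rational coefficients: coefficient lists, constant
-- term first.

Poly : Set
Poly = List ℚ

derivFrom : ℕ → List ℚ → List ℚ
derivFrom k []       = []
derivFrom k (c ∷ cs) = (ℤ.+ k ℚ./ 1) ℚ.* c ∷ derivFrom (suc k) cs

deriv : Poly → Poly
deriv []       = []
deriv (c ∷ cs) = derivFrom 1 cs

evalℚ : Poly → ℚ → ℚ
evalℚ P x = foldr (λ c acc → c ℚ.+ x ℚ.* acc) ℚ.0ℚ P

-- A field of characteristic 0, given as a field together with a ring
-- homomorphism ℚ → K (the library has no Field bundle).
record ExtensionFieldOfℚ : Set₁ where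
  field
    commRing : CommutativeRing 0ℓ 0ℓ
  open CommutativeRing commRing public
  field
    nontrivial : ¬ (1# ≈ 0#)
    inverse    : (x : Carrier) → ¬ (x ≈ 0#) → ∃ λ y → (x * y) ≈ 1#
    ι          : ℚ → Carrier
    ι-+        : (r s : ℚ) → ι (r ℚ.+ s) ≈ (ι r + ι s)
    ι-*        : (r s : ℚ) → ι (r ℚ.* s) ≈ (ι r * ι s)
    ι-1        : ι ℚ.1ℚ ≈ 1#

module _ (K : ExtensionFieldOfℚ) where
  open ExtensionFieldOfℚ K

  evalIn : Poly → Carrier → Carrier
  evalIn P r = foldr (λ c acc → ι c + r * acc) 0# P

  SimpleZero : Poly → Carrier → Set
  SimpleZero P r = (evalIn P r ≈ 0#) × ¬ (evalIn (deriv P) r ≈ 0#)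

-- P has at least three (distinct) simple zeros, located in some
-- extension field of ℚ (equivalently, in ℂ).
HasThreeSimpleZeros : Poly → Set₁
HasThreeSimpleZeros P = Σ ExtensionFieldOfℚ λ K →
  let open ExtensionFieldOfℚ K in
  Σ Carrier λ r₁ → Σ Carrier λ r₂ → Σ Carrier λ r₃ →
    SimpleZero K P r₁ × SimpleZero K P r₂ × SimpleZero K P r₃ ×
    ¬ (r₁ ≈ r₂) × ¬ (r₁ ≈ r₃) × ¬ (r₂ ≈ r₃)

toℚ : ℤ → ℚ
toℚ z = z ℚ./ 1

-- finitely many integer solutions (x, y, z), yz ≠ 0, of y² z³ = P(x):
-- all of them lie in a bounded box
FinitelyManySolutions : Poly → Set
FinitelyManySolutions P = ∃ λ (B : ℕ) → (x y z : ℤ) →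
  ¬ y ≡ ℤ.0ℤ → ¬ z ≡ ℤ.0ℤ →
  toℚ (y ℤ.^ 2 ℤ.* z ℤ.^ 3) ≡ evalℚ P (toℚ x) →
  ∣ x ∣ ≤ B × ∣ y ∣ ≤ B × ∣ z ∣ ≤ B

SchinzelTijdeman : Set₁
SchinzelTijdeman = (P : Poly) → HasThreeSimpleZeros P → FinitelyManySolutions P

module Submission where

-- If H(a₀; a₁, a₂, …) ⊆ W, then with s = a₀ + a₃ + ⋯ + a_k the cube points s, s + a₁ and
-- s + a₁ + a₂ are powerful: there are arbitrarily large s with s, t = s + α and w = t + β all
-- powerful (α = a₁, β = a₂).
--
-- Schinzel–Tijdeman: the powerful number s t w has the form y² z³, giving infinitely many
-- integer points on y² z³ = x (x + α) (x + α + β), a cubic with three simple roots.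
--
-- abc: since s ≡ -α and w ≡ β (mod t), C = s^{2α} w^{2β} ≡ A = α^{2α} β^{2β} (mod t²), the
-- linear terms cancelling.  Write C = A + t² D.  The radical of A t² D C is at most
-- α β rad(t) D rad(s) rad(w), and rad(x)² ≤ x for powerful x makes it O(C / √t); abc with
-- ε = 1/(2 deg C) then bounds t in terms of α and β alone.

module CongruenceModSquare where

  open import Data.Nat as ℕ using (ℕ; zero; suc)
  import Data.Nat.Properties as ℕ
  open import Data.Product using (∃; _,_; proj₁; proj₂)
  open import Function using (_∘_)
  open import Relation.Binary.PropositionalEquality
  open import Data.Integer
    using (ℤ; +_; -_; 0ℤ; 1ℤ; _+_; _-_; _*_; _^_; ∣_∣; _⊖_)
  open import Data.Integer.Properties
    using (pos-+; pos-*; abs-*; ⊖-≥; m-n≡m⊖n; *-zeroʳ)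
  open import Data.Integer.Tactic.RingSolver using (solve-∀)

  ^-modSquare : ∀ T c m → ∃ λ k → (T + c) ^ suc m ≡ c ^ suc m + T * (+ suc m * c ^ m) + T * T * k
  ^-modSquare T c zero    = 0ℤ , lemma T c
    where lemma : ∀ T c → (T + c) * 1ℤ ≡ c * 1ℤ + T * (1ℤ * 1ℤ) + T * T * 0ℤ
          lemma = solve-∀
  ^-modSquare T c (suc m) with ^-modSquare T c m
  ... | k , eq = n * p + (T + c) * k , (begin
    (T + c) * (T + c) ^ suc m
      ≡⟨ cong ((T + c) *_) eq ⟩
    (T + c) * (c * p + T * (n * p) + T * T * k)
      ≡⟨ lemma T c p n k ⟩
    c * (c * p) + T * ((1ℤ + n) * (c * p)) + T * T * (n * p + (T + c) * k)
      ≡⟨ cong (λ x → c * (c * p) + T * (x * (c * p)) + T * T * (n * p + (T + c) * k)) (pos-+ 1 (suc m)) ⟨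
    c * (c * p) + T * (+ suc (suc m) * (c * p)) + T * T * (n * p + (T + c) * k) ∎)
    where
    open ≡-Reasoning
    p = c ^ m
    n = + suc m
    lemma : ∀ T c p n k → (T + c) * (c * p + T * (n * p) + T * T * k) ≡
                          c * (c * p) + T * ((1ℤ + n) * (c * p)) + T * T * (n * p + (T + c) * k)
    lemma = solve-∀

  ^*^-modSquare : ∀ T c₁ c₂ n₁ n₂ .{{_ : ℕ.NonZero n₁}} .{{_ : ℕ.NonZero n₂}} →
    + n₂ * c₁ + + n₁ * c₂ ≡ 0ℤ →
    ∃ λ k → (T + c₁) ^ n₁ * (T + c₂) ^ n₂ ≡ c₁ ^ n₁ * c₂ ^ n₂ + T * T * k
  ^*^-modSquare T c₁ c₂ (suc m₁) (suc m₂) linear≡0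
    with ^-modSquare T c₁ m₁ | ^-modSquare T c₂ m₂
  ... | k₁ , eq₁ | k₂ , eq₂ = K , (begin
    (T + c₁) ^ suc m₁ * (T + c₂) ^ suc m₂
      ≡⟨ cong₂ _*_ eq₁ eq₂ ⟩
    (a₁ + T * d₁ + T * T * k₁) * (a₂ + T * d₂ + T * T * k₂)
      ≡⟨ expand a₁ a₂ d₁ d₂ k₁ k₂ T ⟩
    a₁ * a₂ + T * (a₁ * d₂ + d₁ * a₂) + T * T * K
      ≡⟨ cong (λ x → a₁ * a₂ + T * x + T * T * K) linear≡0′ ⟩
    a₁ * a₂ + T * 0ℤ + T * T * K
      ≡⟨ drop (a₁ * a₂) T K ⟩
    a₁ * a₂ + T * T * K ∎)
    where
    open ≡-Reasoning
    a₁ = c₁ ^ suc m₁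
    a₂ = c₂ ^ suc m₂
    d₁ = + suc m₁ * c₁ ^ m₁
    d₂ = + suc m₂ * c₂ ^ m₂
    K = d₁ * d₂ + a₁ * k₂ + k₁ * a₂ + T * (d₁ * k₂ + k₁ * d₂) + T * T * (k₁ * k₂)
    expand : ∀ a₁ a₂ d₁ d₂ k₁ k₂ T →
      (a₁ + T * d₁ + T * T * k₁) * (a₂ + T * d₂ + T * T * k₂) ≡
      a₁ * a₂ + T * (a₁ * d₂ + d₁ * a₂) +
      T * T * (d₁ * d₂ + a₁ * k₂ + k₁ * a₂ + T * (d₁ * k₂ + k₁ * d₂) + T * T * (k₁ * k₂))
    expand = solve-∀
    factor : ∀ c₁ c₂ p₁ p₂ n₁ n₂ →
             c₁ * p₁ * (n₂ * p₂) + n₁ * p₁ * (c₂ * p₂) ≡ p₁ * p₂ * (n₂ * c₁ + n₁ * c₂)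
    factor = solve-∀
    linear≡0′ : a₁ * d₂ + d₁ * a₂ ≡ 0ℤ
    linear≡0′ = trans (factor c₁ c₂ (c₁ ^ m₁) (c₂ ^ m₂) (+ suc m₁) (+ suc m₂))
                      (trans (cong (c₁ ^ m₁ * c₂ ^ m₂ *_) linear≡0) (*-zeroʳ (c₁ ^ m₁ * c₂ ^ m₂)))
    drop : ∀ a T K → a + T * 0ℤ + T * T * K ≡ a + T * T * K
    drop = solve-∀

  pos-^ : ∀ m n → + (m ℕ.^ n) ≡ (+ m) ^ n
  pos-^ m zero    = refl
  pos-^ m (suc n) = trans (pos-* m (m ℕ.^ n)) (cong (+ m *_) (pos-^ m n))

  -^-even : ∀ x k → (- x) ^ (k ℕ.+ k) ≡ x ^ (k ℕ.+ k)
  -^-even x zero    = refl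
  -^-even x (suc k) rewrite ℕ.+-suc k k =
    trans (cong (λ y → - x * (- x * y)) (-^-even x k)) (lemma x (x ^ (k ℕ.+ k)))
    where lemma : ∀ x y → - x * (- x * y) ≡ x * (x * y)
          lemma = solve-∀


  pos-≡+*⇒≡+* : ∀ {a c d k} → + c ≡ + a + + d * k → a ℕ.≤ c → c ≡ a ℕ.+ d ℕ.* ∣ k ∣
  pos-≡+*⇒≡+* {a} {c} {d} {k} c≡a+dk a≤c = begin
    c                     ≡⟨ ℕ.m+[n∸m]≡n a≤c ⟨
    a ℕ.+ (c ℕ.∸ a)       ≡⟨ cong (a ℕ.+_) (cong ∣_∣ c-a≡dk) ⟩
    a ℕ.+ ∣ + d * k ∣     ≡⟨ cong (a ℕ.+_) (abs-* (+ d) k) ⟩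
    a ℕ.+ d ℕ.* ∣ k ∣     ∎
    where
    open ≡-Reasoning
    c-a≡dk : + (c ℕ.∸ a) ≡ + d * k
    c-a≡dk = begin
      + (c ℕ.∸ a)         ≡⟨ ⊖-≥ a≤c ⟨
      c ⊖ a               ≡⟨ m-n≡m⊖n c a ⟨
      + c - + a           ≡⟨ cong (_- + a) c≡a+dk ⟩
      + a + + d * k - + a ≡⟨ cancel (+ a) (+ d * k) ⟩
      + d * k             ∎
      where cancel : ∀ a x → a + x - a ≡ x
            cancel = solve-∀

  -- With t = s + α and w = t + β we have s ≡ -α and w ≡ β (mod t); the exponents 2α, 2β make the
  -- linear terms of the expansion cancel.
  powerProduct-modSquare : ∀ s α β .{{_ : ℕ.NonZero α}} .{{_ : ℕ.NonZero β}} →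
    let t = s ℕ.+ α
        A = α ℕ.^ (α ℕ.+ α) ℕ.* β ℕ.^ (β ℕ.+ β)
        C = s ℕ.^ (α ℕ.+ α) ℕ.* (t ℕ.+ β) ℕ.^ (β ℕ.+ β)
    in A ℕ.≤ C → ∃ λ D → C ≡ A ℕ.+ t ℕ.* t ℕ.* D
  powerProduct-modSquare s α β A≤C =
    ∣ k ∣ , pos-≡+*⇒≡+* {d = (s ℕ.+ α) ℕ.* (s ℕ.+ α)} {k = k} +C≡+A+ttk A≤C
    where
    open ≡-Reasoning
    n₁ = α ℕ.+ α
    n₂ = β ℕ.+ β
    T = + (s ℕ.+ α)
    instance
      n₁≢0 : ℕ.NonZero n₁
      n₁≢0 = ℕ.≢-nonZero (ℕ.≢-nonZero⁻¹ α ∘ ℕ.m+n≡0⇒m≡0 α)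
      n₂≢0 : ℕ.NonZero n₂
      n₂≢0 = ℕ.≢-nonZero (ℕ.≢-nonZero⁻¹ β ∘ ℕ.m+n≡0⇒m≡0 β)
    linear≡0 : + n₂ * (- + α) + + n₁ * + β ≡ 0ℤ
    linear≡0 = trans (cong₂ (λ x y → x * (- + α) + y * + β) (pos-+ β β) (pos-+ α α)) (lemma (+ α) (+ β))
      where lemma : ∀ a b → (b + b) * (- a) + (a + a) * b ≡ 0ℤ
            lemma = solve-∀
    k : ℤ
    k = proj₁ (^*^-modSquare T (- + α) (+ β) n₁ n₂ linear≡0)
    congruence : (T + - + α) ^ n₁ * (T + + β) ^ n₂ ≡ (- + α) ^ n₁ * (+ β) ^ n₂ + T * T * k
    congruence = proj₂ (^*^-modSquare T (- + α) (+ β) n₁ n₂ linear≡0)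
    pos-*-^ : ∀ x y m n → + (x ℕ.^ m ℕ.* y ℕ.^ n) ≡ (+ x) ^ m * (+ y) ^ n
    pos-*-^ x y m n = trans (pos-* (x ℕ.^ m) (y ℕ.^ n)) (cong₂ _*_ (pos-^ x m) (pos-^ y n))
    s≡T-α : + s ≡ T + - + α
    s≡T-α = trans (lemma (+ s) (+ α)) (cong (_+ - + α) (pos-+ s α))
      where lemma : ∀ s a → s ≡ (s + a) + - a
            lemma = solve-∀
    w≡T+β : + (s ℕ.+ α ℕ.+ β) ≡ T + + β
    w≡T+β = pos-+ (s ℕ.+ α) β
    +C≡+A+ttk : + (s ℕ.^ n₁ ℕ.* (s ℕ.+ α ℕ.+ β) ℕ.^ n₂) ≡
                + (α ℕ.^ n₁ ℕ.* β ℕ.^ n₂) + + ((s ℕ.+ α) ℕ.* (s ℕ.+ α)) * k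
    +C≡+A+ttk = begin
      + (s ℕ.^ n₁ ℕ.* (s ℕ.+ α ℕ.+ β) ℕ.^ n₂)
        ≡⟨ pos-*-^ s (s ℕ.+ α ℕ.+ β) n₁ n₂ ⟩
      (+ s) ^ n₁ * (+ (s ℕ.+ α ℕ.+ β)) ^ n₂
        ≡⟨ cong₂ (λ x y → x ^ n₁ * y ^ n₂) s≡T-α w≡T+β ⟩
      (T + - + α) ^ n₁ * (T + + β) ^ n₂
        ≡⟨ congruence ⟩
      (- + α) ^ n₁ * (+ β) ^ n₂ + T * T * k
        ≡⟨ cong₂ (λ x y → x * (+ β) ^ n₂ + y * k) (sym (-^-even (+ α) α)) (pos-* (s ℕ.+ α) (s ℕ.+ α)) ⟨
      (+ α) ^ n₁ * (+ β) ^ n₂ + + ((s ℕ.+ α) ℕ.* (s ℕ.+ α)) * k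
        ≡⟨ cong (_+ + ((s ℕ.+ α) ℕ.* (s ℕ.+ α)) * k) (pos-*-^ α β n₁ n₂) ⟨
      + (α ℕ.^ n₁ ℕ.* β ℕ.^ n₂) + + ((s ℕ.+ α) ℕ.* (s ℕ.+ α)) * k ∎

module Cubic where

  open import Defs
  open import Data.Nat as ℕ using (ℕ; zero; suc)
  import Data.Nat.Properties as ℕ
  open import Data.Integer using (ℤ; +_; -_; 0ℤ; 1ℤ; _+_; _-_; _*_; _^_)
  open import Data.Integer.Properties
    using (pos-+; pos-*; neg-injective; +-injective; i*j≡0⇒i≡0∨j≡0; +-identityˡ; *-identityʳ)
  open import Function using (_∘_)
  open import Data.Integer.Tactic.RingSolver using (solve-∀)
  open CongruenceModSquare using (pos-^)
  import Data.Rational as ℚ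
  import Data.Rational.Properties as ℚ
  import Data.Rational.Unnormalised as ℚᵘ
  import Data.Rational.Unnormalised.Properties as ℚᵘ
  open import Data.List using (List; []; _∷_; map; foldr)
  open import Data.Product using (_×_; _,_)
  open import Data.Sum using ([_,_]′)
  open import Relation.Binary.PropositionalEquality

  toℚ≃ : ∀ z → ℚ.toℚᵘ (toℚ z) ℚᵘ.≃ ℚᵘ.mkℚᵘ z 0
  toℚ≃ z = ℚ.toℚᵘ-fromℚᵘ (ℚᵘ.mkℚᵘ z 0)

  toℚ-+ : ∀ z w → toℚ (z + w) ≡ toℚ z ℚ.+ toℚ w
  toℚ-+ z w = ℚ.toℚᵘ-injective (begin
    ℚ.toℚᵘ (toℚ (z + w))                     ≈⟨ toℚ≃ (z + w) ⟩
    ℚᵘ.mkℚᵘ (z + w) 0                        ≈⟨ ℚᵘ.*≡* (lemma z w) ⟩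
    ℚᵘ.mkℚᵘ z 0 ℚᵘ.+ ℚᵘ.mkℚᵘ w 0             ≈⟨ ℚᵘ.+-cong (toℚ≃ z) (toℚ≃ w) ⟨
    ℚ.toℚᵘ (toℚ z) ℚᵘ.+ ℚ.toℚᵘ (toℚ w)       ≈⟨ ℚ.toℚᵘ-homo-+ (toℚ z) (toℚ w) ⟨
    ℚ.toℚᵘ (toℚ z ℚ.+ toℚ w)                 ∎)
    where
    open ℚᵘ.≃-Reasoning
    lemma : ∀ z w → (z + w) * 1ℤ ≡ (z * 1ℤ + w * 1ℤ) * 1ℤ
    lemma = solve-∀

  toℚ-* : ∀ z w → toℚ (z * w) ≡ toℚ z ℚ.* toℚ w
  toℚ-* z w = ℚ.toℚᵘ-injective (begin
    ℚ.toℚᵘ (toℚ (z * w))                     ≈⟨ toℚ≃ (z * w) ⟩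
    ℚᵘ.mkℚᵘ z 0 ℚᵘ.* ℚᵘ.mkℚᵘ w 0             ≈⟨ ℚᵘ.*-cong (toℚ≃ z) (toℚ≃ w) ⟨
    ℚ.toℚᵘ (toℚ z) ℚᵘ.* ℚ.toℚᵘ (toℚ w)       ≈⟨ ℚ.toℚᵘ-homo-* (toℚ z) (toℚ w) ⟨
    ℚ.toℚᵘ (toℚ z ℚ.* toℚ w)                 ∎)
    where open ℚᵘ.≃-Reasoning

  toℚ-injective : ∀ {z w} → toℚ z ≡ toℚ w → z ≡ w
  toℚ-injective {z} {w} eq
    with ℚᵘ.≃-trans (ℚᵘ.≃-sym (toℚ≃ z))
                    (ℚᵘ.≃-trans (ℚᵘ.≃-reflexive (cong ℚ.toℚᵘ eq)) (toℚ≃ w))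
  ... | ℚᵘ.*≡* z*1≡w*1 = trans (sym (*-identityʳ z)) (trans z*1≡w*1 (*-identityʳ w))

  evalℤ : List ℤ → ℤ → ℤ
  evalℤ P x = foldr (λ c acc → c + x * acc) 0ℤ P

  derivFromℤ : ℕ → List ℤ → List ℤ
  derivFromℤ k []       = []
  derivFromℤ k (c ∷ cs) = + k * c ∷ derivFromℤ (suc k) cs

  derivℤ : List ℤ → List ℤ
  derivℤ []       = []
  derivℤ (c ∷ cs) = derivFromℤ 1 cs

  evalℚ-toℚ : ∀ P x → evalℚ (map toℚ P) (toℚ x) ≡ toℚ (evalℤ P x)
  evalℚ-toℚ []       x = refl
  evalℚ-toℚ (c ∷ cs) x = begin
    toℚ c ℚ.+ toℚ x ℚ.* evalℚ (map toℚ cs) (toℚ x)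
      ≡⟨ cong ((toℚ c ℚ.+_) ∘ (toℚ x ℚ.*_)) (evalℚ-toℚ cs x) ⟩
    toℚ c ℚ.+ toℚ x ℚ.* toℚ (evalℤ cs x)
      ≡⟨ cong (toℚ c ℚ.+_) (toℚ-* x (evalℤ cs x)) ⟨
    toℚ c ℚ.+ toℚ (x * evalℤ cs x)
      ≡⟨ toℚ-+ c (x * evalℤ cs x) ⟨
    toℚ (c + x * evalℤ cs x) ∎
    where open ≡-Reasoning

  derivFrom-toℚ : ∀ k P → derivFrom k (map toℚ P) ≡ map toℚ (derivFromℤ k P)
  derivFrom-toℚ k []       = refl
  derivFrom-toℚ k (c ∷ cs) = cong₂ _∷_ (sym (toℚ-* (+ k) c)) (derivFrom-toℚ (suc k) cs)

  deriv-toℚ : ∀ P → deriv (map toℚ P) ≡ map toℚ (derivℤ P)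
  deriv-toℚ []       = refl
  deriv-toℚ (c ∷ cs) = derivFrom-toℚ 1 cs

  ℚ-extensionField : ExtensionFieldOfℚ
  ℚ-extensionField = record
    { commRing   = ℚ.+-*-commutativeRing
    ; nontrivial = ℚ.1≢0
    ; inverse    = λ x x≢0 → ℚ.1/_ x {{ℚ.≢-nonZero x≢0}} , ℚ.*-inverseʳ x {{ℚ.≢-nonZero x≢0}}
    ; ι          = λ x → x
    ; ι-+        = λ _ _ → refl
    ; ι-*        = λ _ _ → refl
    ; ι-1        = refl
    }

  simpleZero-toℚ : ∀ P r → evalℤ P r ≡ 0ℤ → evalℤ (derivℤ P) r ≢ 0ℤ →
                   SimpleZero ℚ-extensionField (map toℚ P) (toℚ r)
  simpleZero-toℚ P r P[r]≡0 P′[r]≢0 =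
    trans (evalℚ-toℚ P r) (cong toℚ P[r]≡0) ,
    λ P′[r]≡0 → P′[r]≢0 (toℚ-injective (begin
      toℚ (evalℤ (derivℤ P) r)            ≡⟨ evalℚ-toℚ (derivℤ P) r ⟨
      evalℚ (map toℚ (derivℤ P)) (toℚ r)  ≡⟨ cong (λ Q → evalℚ Q (toℚ r)) (deriv-toℚ P) ⟨
      evalℚ (deriv (map toℚ P)) (toℚ r)   ≡⟨ P′[r]≡0 ⟩
      ℚ.0ℚ                                ∎))
    where open ≡-Reasoning

  evalℤ-cubic : ∀ a b c d x → evalℤ (a ∷ b ∷ c ∷ d ∷ []) x ≡ a + b * x + c * x * x + d * x * x * x
  evalℤ-cubic a b c d x = lemma a b c d x
    where lemma : ∀ a b c d x → a + x * (b + x * (c + x * (d + x * 0ℤ))) ≡ a + b * x + c * x * x + d * x * x * x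
          lemma = solve-∀

  evalℤ-derivℤ-cubic : ∀ a b c d x →
    evalℤ (derivℤ (a ∷ b ∷ c ∷ d ∷ [])) x ≡ b + + 2 * c * x + + 3 * d * x * x
  evalℤ-derivℤ-cubic a b c d x = lemma b c d x
    where lemma : ∀ b c d x → + 1 * b + x * (+ 2 * c + x * (+ 3 * d + x * 0ℤ)) ≡ b + + 2 * c * x + + 3 * d * x * x
          lemma = solve-∀

  cubicWithRoots : ℤ → ℤ → ℤ → List ℤ
  cubicWithRoots r₁ r₂ r₃ =
    - (r₁ * r₂ * r₃) ∷ r₁ * r₂ + r₁ * r₃ + r₂ * r₃ ∷ - (r₁ + r₂ + r₃) ∷ 1ℤ ∷ []

  cubicWithRoots-eval : ∀ r₁ r₂ r₃ x →
    evalℤ (cubicWithRoots r₁ r₂ r₃) x ≡ (x - r₁) * (x - r₂) * (x - r₃)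
  cubicWithRoots-eval r₁ r₂ r₃ x =
    trans (evalℤ-cubic (- (r₁ * r₂ * r₃)) (r₁ * r₂ + r₁ * r₃ + r₂ * r₃) (- (r₁ + r₂ + r₃)) 1ℤ x)
          (lemma r₁ r₂ r₃ x)
    where lemma : ∀ r₁ r₂ r₃ x → - (r₁ * r₂ * r₃) + (r₁ * r₂ + r₁ * r₃ + r₂ * r₃) * x +
                                  - (r₁ + r₂ + r₃) * x * x + 1ℤ * x * x * x ≡ (x - r₁) * (x - r₂) * (x - r₃)
          lemma = solve-∀

  cubicWithRoots-deriv : ∀ r₁ r₂ r₃ x → evalℤ (derivℤ (cubicWithRoots r₁ r₂ r₃)) x ≡
                         (x - r₂) * (x - r₃) + (x - r₁) * (x - r₃) + (x - r₁) * (x - r₂)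
  cubicWithRoots-deriv r₁ r₂ r₃ x =
    trans (evalℤ-derivℤ-cubic (- (r₁ * r₂ * r₃)) (r₁ * r₂ + r₁ * r₃ + r₂ * r₃) (- (r₁ + r₂ + r₃)) 1ℤ x)
          (lemma r₁ r₂ r₃ x)
    where lemma : ∀ r₁ r₂ r₃ x →
                  (r₁ * r₂ + r₁ * r₃ + r₂ * r₃) + + 2 * - (r₁ + r₂ + r₃) * x + + 3 * 1ℤ * x * x ≡
                                  (x - r₂) * (x - r₃) + (x - r₁) * (x - r₃) + (x - r₁) * (x - r₂)
          lemma = solve-∀

  cubicWithRoots-simpleZeros : ∀ r₁ r₂ r₃ → r₁ ≢ r₂ → r₁ ≢ r₃ → r₂ ≢ r₃ →
    HasThreeSimpleZeros (map toℚ (cubicWithRoots r₁ r₂ r₃))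
  cubicWithRoots-simpleZeros r₁ r₂ r₃ r₁≢r₂ r₁≢r₃ r₂≢r₃ =
    ℚ-extensionField , toℚ r₁ , toℚ r₂ , toℚ r₃ ,
    simpleZero-toℚ P r₁ (vanishes r₁ (root₁ r₁ r₂ r₃))
      (≡product⇒≢0 (slope r₁ (deriv₁ r₁ r₂ r₃)) r₁≢r₂ r₁≢r₃) ,
    simpleZero-toℚ P r₂ (vanishes r₂ (root₂ r₁ r₂ r₃))
      (≡product⇒≢0 (slope r₂ (deriv₂ r₁ r₂ r₃)) (≢-sym r₁≢r₂) r₂≢r₃) ,
    simpleZero-toℚ P r₃ (vanishes r₃ (root₃ r₁ r₂ r₃))
      (≡product⇒≢0 (slope r₃ (deriv₃ r₁ r₂ r₃)) (≢-sym r₁≢r₃) (≢-sym r₂≢r₃)) ,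
    r₁≢r₂ ∘ toℚ-injective , r₁≢r₃ ∘ toℚ-injective , r₂≢r₃ ∘ toℚ-injective
    where
    P = cubicWithRoots r₁ r₂ r₃
    vanishes : ∀ r → (r - r₁) * (r - r₂) * (r - r₃) ≡ 0ℤ → evalℤ P r ≡ 0ℤ
    vanishes r = trans (cubicWithRoots-eval r₁ r₂ r₃ r)
    slope : ∀ {D} r → (r - r₂) * (r - r₃) + (r - r₁) * (r - r₃) + (r - r₁) * (r - r₂) ≡ D →
            evalℤ (derivℤ P) r ≡ D
    slope r = trans (cubicWithRoots-deriv r₁ r₂ r₃ r)
    difference≢0 : ∀ {x y} → x ≢ y → x - y ≢ 0ℤ
    difference≢0 {x} {y} x≢y x-y≡0 = x≢y (trans (lemma x y) (trans (cong (_+ y) x-y≡0) (+-identityˡ y)))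
      where lemma : ∀ x y → x ≡ (x - y) + y
            lemma = solve-∀
    ≡product⇒≢0 : ∀ {D r s t} → D ≡ (r - s) * (r - t) → r ≢ s → r ≢ t → D ≢ 0ℤ
    ≡product⇒≢0 {r = r} {s} refl r≢s r≢t D≡0 =
      [ difference≢0 r≢s , difference≢0 r≢t ]′ (i*j≡0⇒i≡0∨j≡0 (r - s) D≡0)
    root₁ : ∀ r₁ r₂ r₃ → (r₁ - r₁) * (r₁ - r₂) * (r₁ - r₃) ≡ 0ℤ
    root₁ = solve-∀
    root₂ : ∀ r₁ r₂ r₃ → (r₂ - r₁) * (r₂ - r₂) * (r₂ - r₃) ≡ 0ℤ
    root₂ = solve-∀
    root₃ : ∀ r₁ r₂ r₃ → (r₃ - r₁) * (r₃ - r₂) * (r₃ - r₃) ≡ 0ℤ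
    root₃ = solve-∀
    deriv₁ : ∀ r₁ r₂ r₃ → (r₁ - r₂) * (r₁ - r₃) + (r₁ - r₁) * (r₁ - r₃) + (r₁ - r₁) * (r₁ - r₂) ≡
                          (r₁ - r₂) * (r₁ - r₃)
    deriv₁ = solve-∀
    deriv₂ : ∀ r₁ r₂ r₃ → (r₂ - r₂) * (r₂ - r₃) + (r₂ - r₁) * (r₂ - r₃) + (r₂ - r₁) * (r₂ - r₂) ≡
                          (r₂ - r₁) * (r₂ - r₃)
    deriv₂ = solve-∀
    deriv₃ : ∀ r₁ r₂ r₃ → (r₃ - r₂) * (r₃ - r₃) + (r₃ - r₁) * (r₃ - r₃) + (r₃ - r₁) * (r₃ - r₂) ≡
                          (r₃ - r₁) * (r₃ - r₂)
    deriv₃ = solve-∀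

  negPos-injective : ∀ {m n} → m ≢ n → - + m ≢ - + n
  negPos-injective m≢n = m≢n ∘ +-injective ∘ neg-injective

  shiftedCubic : ℕ → ℕ → Poly
  shiftedCubic α β = map toℚ (cubicWithRoots 0ℤ (- + α) (- + (α ℕ.+ β)))

  shiftedCubic-simpleZeros : ∀ α β .{{_ : ℕ.NonZero α}} .{{_ : ℕ.NonZero β}} →
    HasThreeSimpleZeros (shiftedCubic α β)
  shiftedCubic-simpleZeros α β = cubicWithRoots-simpleZeros _ _ _
    (negPos-injective (ℕ.<⇒≢ (ℕ.>-nonZero⁻¹ α)))
    (negPos-injective (ℕ.<⇒≢ (ℕ.<-≤-trans (ℕ.>-nonZero⁻¹ α) (ℕ.m≤m+n α β))))
    (negPos-injective (ℕ.<⇒≢ (ℕ.m<m+n α (ℕ.>-nonZero⁻¹ β))))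

  shiftedCubic-evalℤ : ∀ α β u →
    evalℤ (cubicWithRoots 0ℤ (- + α) (- + (α ℕ.+ β))) (+ u) ≡ + (u ℕ.* (u ℕ.+ α) ℕ.* (u ℕ.+ α ℕ.+ β))
  shiftedCubic-evalℤ α β u = begin
    evalℤ (cubicWithRoots 0ℤ (- + α) (- + (α ℕ.+ β))) (+ u)
      ≡⟨ cubicWithRoots-eval 0ℤ (- + α) (- + (α ℕ.+ β)) (+ u) ⟩
    (+ u - 0ℤ) * (+ u - - + α) * (+ u - - + (α ℕ.+ β))
      ≡⟨ lemma (+ u) (+ α) (+ (α ℕ.+ β)) ⟩
    + u * (+ u + + α) * (+ u + + (α ℕ.+ β))
      ≡⟨ cong₂ (λ v w → + u * v * w) (pos-+ u α) (pos-+ u (α ℕ.+ β)) ⟨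
    + u * + (u ℕ.+ α) * + (u ℕ.+ (α ℕ.+ β))
      ≡⟨ cong (_* + (u ℕ.+ (α ℕ.+ β))) (pos-* u (u ℕ.+ α)) ⟨
    + (u ℕ.* (u ℕ.+ α)) * + (u ℕ.+ (α ℕ.+ β))
      ≡⟨ pos-* (u ℕ.* (u ℕ.+ α)) (u ℕ.+ (α ℕ.+ β)) ⟨
    + (u ℕ.* (u ℕ.+ α) ℕ.* (u ℕ.+ (α ℕ.+ β)))
      ≡⟨ cong (λ v → + (u ℕ.* (u ℕ.+ α) ℕ.* v)) (ℕ.+-assoc u α β) ⟨
    + (u ℕ.* (u ℕ.+ α) ℕ.* (u ℕ.+ α ℕ.+ β)) ∎
    where
    open ≡-Reasoning
    lemma : ∀ x a c → (x - 0ℤ) * (x - - a) * (x - - c) ≡ x * (x + a) * (x + c)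
    lemma = solve-∀

  shiftedCubic-solution : ∀ α β u y z → u ℕ.* (u ℕ.+ α) ℕ.* (u ℕ.+ α ℕ.+ β) ≡ y ℕ.^ 2 ℕ.* z ℕ.^ 3 →
    toℚ ((+ y) ^ 2 * (+ z) ^ 3) ≡ evalℚ (shiftedCubic α β) (toℚ (+ u))
  shiftedCubic-solution α β u y z u[u+α][u+α+β]≡y²z³ = sym (begin
    evalℚ (shiftedCubic α β) (toℚ (+ u))
      ≡⟨ evalℚ-toℚ (cubicWithRoots 0ℤ (- + α) (- + (α ℕ.+ β))) (+ u) ⟩
    toℚ (evalℤ (cubicWithRoots 0ℤ (- + α) (- + (α ℕ.+ β))) (+ u))
      ≡⟨ cong toℚ (shiftedCubic-evalℤ α β u) ⟩
    toℚ (+ (u ℕ.* (u ℕ.+ α) ℕ.* (u ℕ.+ α ℕ.+ β)))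
      ≡⟨ cong (λ n → toℚ (+ n)) u[u+α][u+α+β]≡y²z³ ⟩
    toℚ (+ (y ℕ.^ 2 ℕ.* z ℕ.^ 3))
      ≡⟨ cong toℚ (trans (pos-* (y ℕ.^ 2) (z ℕ.^ 3)) (cong₂ _*_ (pos-^ y 2) (pos-^ z 3))) ⟩
    toℚ ((+ y) ^ 2 * (+ z) ^ 3) ∎)
    where open ≡-Reasoning

module PowerfulNumbers where

  open import Defs
  open import Data.Bool using (Bool; true; false; if_then_else_)
  open import Data.Nat
  open import Data.Nat.Properties
  open import Data.Nat.Divisibility
  open import Data.Nat.Primality
  open import Data.Nat.GCD using (gcd; gcd[m,n]∣m; gcd[m,n]∣n; gcd[m,n]≢0; c*gcd[m,n]≡gcd[cm,cn]; gcd-zeroˡ)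
  open import Data.Nat.Primality.Factorisation using (factorise)
  open import Data.Nat.Induction using (<-wellFounded)
  open import Induction.WellFounded using (Acc; acc)
  open import Data.Nat.ListAction using (product)
  open import Data.Nat.ListAction.Properties using (product-++)
  open import Data.Nat.Tactic.RingSolver using (solve-∀)
  open import Algebra.Properties.CommutativeSemigroup *-commutativeSemigroup using (x∙yz≈y∙xz)
  open import Data.List using ([]; _∷_; _++_; filter; upTo)
  open import Data.List.Relation.Unary.All using (_∷_)
  open import Data.List.Properties using (upTo-∷ʳ; filter-++; filter-accept; filter-reject)
  open import Data.Product using (∃; ∃₂; _×_; _,_; proj₁)
  open import Data.Sum using (_⊎_; inj₁; inj₂; [_,_]′)
  open import Data.Empty using (⊥-elim)
  open import Function using (_∘_; id)
  open import Relation.Nullary using (¬_; yes; no; contradiction)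
  open import Relation.Nullary.Decidable using (_×-dec_)
  open import Relation.Unary using (Decidable)
  open import Relation.Binary.PropositionalEquality
  import Data.Integer as ℤ
  import Data.Integer.Properties as ℤ
  open CongruenceModSquare using (powerProduct-modSquare)
  open Cubic using (shiftedCubic; shiftedCubic-simpleZeros; shiftedCubic-solution)

  private variable
    m n p : ℕ

  ^-distribʳ-* : ∀ m n o → (m * n) ^ o ≡ m ^ o * n ^ o
  ^-distribʳ-* m n zero    = refl
  ^-distribʳ-* m n (suc o) = begin
    m * n * (m * n) ^ o       ≡⟨ cong (m * n *_) (^-distribʳ-* m n o) ⟩
    m * n * (m ^ o * n ^ o)   ≡⟨ [m*n]*[o*p]≡[m*o]*[n*p] m n (m ^ o) (n ^ o) ⟩
    m * m ^ o * (n * n ^ o)   ∎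
    where open ≡-Reasoning

  -- Primes and the radical

  prime>1 : Prime p → 1 < p
  prime>1 {p} pr = nonTrivial⇒n>1 p {{prime⇒nonTrivial pr}}

  prime∤1 : Prime p → ¬ p ∣ 1
  prime∤1 pr p∣1 = <⇒≢ (prime>1 pr) (sym (∣1⇒≡1 p∣1))

  prime∣^⇒∣ : ∀ k → Prime p → p ∣ m ^ k → p ∣ m
  prime∣^⇒∣ zero    pr p∣1 = ⊥-elim (prime∤1 pr p∣1)
  prime∣^⇒∣ {m = m} (suc k) pr p∣m^k+1 =
    [ id , prime∣^⇒∣ k pr ]′ (euclidsLemma m (m ^ k) pr p∣m^k+1)

  prime^∣*⇒prime^∣ : ∀ e → Prime p → ¬ p ∣ m → p ^ e ∣ n * m → p ^ e ∣ n
  prime^∣*⇒prime^∣ zero pr p∤m _ = 1∣ _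
  prime^∣*⇒prime^∣ {p} {m} {n} (suc e) pr p∤m p^e+1∣nm
    with euclidsLemma n m pr (∣-trans (m∣m*n (p ^ e)) p^e+1∣nm)
  ... | inj₂ p∣m = contradiction p∣m p∤m
  ... | inj₁ (divides k refl) = subst (p * p ^ e ∣_) (*-comm p k) (*-monoʳ-∣ p p^e∣k)
    where
    p^e∣k : p ^ e ∣ k
    p^e∣k = prime^∣*⇒prime^∣ e pr p∤m
      (*-cancelˡ-∣ p {{prime⇒nonZero pr}}
        (subst (p * p ^ e ∣_) (trans (cong (_* m) (*-comm k p)) (*-assoc p k m)) p^e+1∣nm))

  PrimeDivisor : ℕ → ℕ → Set
  PrimeDivisor n p = Prime p × p ∣ n

  primeDivisor? : ∀ n → Decidable (PrimeDivisor n)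
  primeDivisor? n p = prime? p ×-dec p ∣? n

  -- rad n is radBelow (suc n) n by definition.
  radBelow : ℕ → ℕ → ℕ
  radBelow N n = product (filter (primeDivisor? n) (upTo N))

  radFactor : ℕ → ℕ → ℕ
  radFactor n N = product (filter (primeDivisor? n) (N ∷ []))

  radBelow-suc : ∀ N n → radBelow (suc N) n ≡ radBelow N n * radFactor n N
  radBelow-suc N n = begin
    product (filter (primeDivisor? n) (upTo (suc N)))
      ≡⟨ cong (product ∘ filter (primeDivisor? n)) (sym (upTo-∷ʳ N)) ⟩
    product (filter (primeDivisor? n) (upTo N ++ N ∷ []))
      ≡⟨ cong product (filter-++ (primeDivisor? n) (upTo N) (N ∷ [])) ⟩
    product (filter (primeDivisor? n) (upTo N) ++ filter (primeDivisor? n) (N ∷ []))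
      ≡⟨ product-++ (filter (primeDivisor? n) (upTo N)) (filter (primeDivisor? n) (N ∷ [])) ⟩
    radBelow N n * radFactor n N ∎
    where open ≡-Reasoning

  radFactor-accept : ∀ {n N} → PrimeDivisor n N → radFactor n N ≡ N
  radFactor-accept {n} {N} pd =
    trans (cong product (filter-accept (primeDivisor? n) {N} {[]} pd)) (*-identityʳ N)

  radFactor-reject : ∀ {n N} → ¬ PrimeDivisor n N → radFactor n N ≡ 1
  radFactor-reject {n} {N} ¬pd = cong product (filter-reject (primeDivisor? n) {N} {[]} ¬pd)

  radFactor≥1 : ∀ n N → 1 ≤ radFactor n N
  radFactor≥1 n N with primeDivisor? n N
  ... | yes pd@(pr , _) = subst (1 ≤_) (sym (radFactor-accept pd)) (<⇒≤ (prime>1 pr))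
  ... | no ¬pd          = ≤-reflexive (sym (radFactor-reject ¬pd))

  radFactor-mono : ∀ {m n} → (∀ p → PrimeDivisor m p → p ∣ n) →
                   ∀ N → radFactor m N ≤ radFactor n N
  radFactor-mono {m} {n} m⊆n N with primeDivisor? m N
  ... | no ¬pd = subst (_≤ radFactor n N) (sym (radFactor-reject ¬pd)) (radFactor≥1 n N)
  ... | yes pd@(pr , _) = ≤-reflexive
    (trans (radFactor-accept pd) (sym (radFactor-accept (pr , m⊆n N pd))))

  radFactor-* : ∀ m n N → radFactor (m * n) N ≤ radFactor m N * radFactor n N
  radFactor-* m n N with primeDivisor? (m * n) N
  ... | no ¬pd = subst (_≤ radFactor m N * radFactor n N) (sym (radFactor-reject ¬pd))
                   (*-mono-≤ (radFactor≥1 m N) (radFactor≥1 n N))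
  ... | yes pd@(pr , N∣mn) with euclidsLemma m n pr N∣mn
  ...   | inj₁ N∣m = begin
    radFactor (m * n) N           ≡⟨ radFactor-accept pd ⟩
    N                             ≡⟨ radFactor-accept (pr , N∣m) ⟨
    radFactor m N                 ≤⟨ m≤m*n _ (radFactor n N) {{>-nonZero (radFactor≥1 n N)}} ⟩
    radFactor m N * radFactor n N ∎
    where open ≤-Reasoning
  ...   | inj₂ N∣n = begin
    radFactor (m * n) N           ≡⟨ radFactor-accept pd ⟩
    N                             ≡⟨ radFactor-accept (pr , N∣n) ⟨
    radFactor n N                 ≤⟨ m≤n*m _ (radFactor m N) {{>-nonZero (radFactor≥1 m N)}} ⟩
    radFactor m N * radFactor n N ∎
    where open ≤-Reasoning

  radBelow-mono : ∀ {m n} → (∀ p → PrimeDivisor m p → p ∣ n) →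
                  ∀ N → radBelow N m ≤ radBelow N n
  radBelow-mono m⊆n zero = ≤-refl
  radBelow-mono {m} {n} m⊆n (suc N) rewrite radBelow-suc N m | radBelow-suc N n =
    *-mono-≤ (radBelow-mono m⊆n N) (radFactor-mono m⊆n N)

  radBelow-* : ∀ m n N → radBelow N (m * n) ≤ radBelow N m * radBelow N n
  radBelow-* m n zero = ≤-refl
  radBelow-* m n (suc N) rewrite radBelow-suc N (m * n) | radBelow-suc N m | radBelow-suc N n =
    ≤-trans (*-mono-≤ (radBelow-* m n N) (radFactor-* m n N))
            (≤-reflexive ([m*n]*[o*p]≡[m*o]*[n*p] (radBelow N m) (radBelow N n) _ _))

  prime∣radBelow⇒< : ∀ {p} N n → Prime p → p ∣ radBelow N n → p < N
  prime∣radBelow⇒< zero n pr p∣1 = ⊥-elim (prime∤1 pr p∣1)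
  prime∣radBelow⇒< {p} (suc N) n pr p∣rad rewrite radBelow-suc N n
    with euclidsLemma (radBelow N n) (radFactor n N) pr p∣rad
  ... | inj₁ p∣radBelow = m<n⇒m<1+n (prime∣radBelow⇒< N n pr p∣radBelow)
  ... | inj₂ p∣factor with primeDivisor? n N
  ...   | no ¬pd = ⊥-elim (prime∤1 pr (subst (p ∣_) (radFactor-reject ¬pd) p∣factor))
  ...   | yes pd@(prN , _) with prime⇒irreducible prN (subst (p ∣_) (radFactor-accept pd) p∣factor)
  ...     | inj₁ refl = ⊥-elim (<-irrefl refl (prime>1 pr))
  ...     | inj₂ refl = ≤-refl

  radBelow^e∣ : ∀ {n} e → (∀ p → PrimeDivisor n p → p ^ e ∣ n) → ∀ N → radBelow N n ^ e ∣ n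
  radBelow^e∣ e pd⇒p^e∣ zero = subst (_∣ _) (sym (^-zeroˡ e)) (1∣ _)
  radBelow^e∣ {n} e pd⇒p^e∣ (suc N)
    rewrite radBelow-suc N n | ^-distribʳ-* (radBelow N n) (radFactor n N) e
    with primeDivisor? n N | radBelow^e∣ e pd⇒p^e∣ N
  ... | no ¬pd | r^e∣n rewrite radFactor-reject ¬pd | ^-zeroˡ e | *-identityʳ (radBelow N n ^ e) = r^e∣n
  ... | yes pd@(prN , _) | divides k n≡k*r^e rewrite radFactor-accept pd =
    subst (radBelow N n ^ e * N ^ e ∣_) (sym (trans n≡k*r^e (*-comm k _)))
      (*-monoʳ-∣ (radBelow N n ^ e) (prime^∣*⇒prime^∣ e prN N∤r^e (subst (N ^ e ∣_) n≡k*r^e (pd⇒p^e∣ N pd))))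
    where
    N∤r^e : ¬ N ∣ radBelow N n ^ e
    N∤r^e N∣r^e = <-irrefl refl (prime∣radBelow⇒< N n prN (prime∣^⇒∣ e prN N∣r^e))

  radBelow-stable : ∀ n .{{_ : NonZero n}} N → n < N → radBelow N n ≡ rad n
  radBelow-stable n N n<N with m≤n⇒∃[o]m+o≡n n<N
  ... | k , refl = go k
    where
    go : ∀ k → radBelow (suc n + k) n ≡ rad n
    go zero    = cong (λ N → radBelow N n) (+-identityʳ (suc n))
    go (suc k) = begin
      radBelow (suc n + suc k) n                       ≡⟨ cong (λ N → radBelow N n) (+-suc (suc n) k) ⟩
      radBelow (suc (suc n + k)) n                     ≡⟨ radBelow-suc (suc n + k) n ⟩
      radBelow (suc n + k) n * radFactor n (suc n + k) ≡⟨ cong (radBelow (suc n + k) n *_) (radFactor-reject too-large) ⟩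
      radBelow (suc n + k) n * 1                       ≡⟨ *-identityʳ _ ⟩
      radBelow (suc n + k) n                           ≡⟨ go k ⟩
      rad n                                            ∎
      where
      open ≡-Reasoning
      too-large : ¬ PrimeDivisor n (suc n + k)
      too-large (_ , d) = <⇒≱ (s≤s (m≤m+n n k)) (∣⇒≤ d)

  rad-mono : ∀ m n .{{_ : NonZero m}} .{{_ : NonZero n}} →
             (∀ p → PrimeDivisor m p → p ∣ n) → rad m ≤ rad n
  rad-mono m n m⊆n = subst₂ _≤_
    (radBelow-stable m (suc (m + n)) (s≤s (m≤m+n m n)))
    (radBelow-stable n (suc (m + n)) (s≤s (m≤n+m n m)))
    (radBelow-mono m⊆n (suc (m + n)))

  rad-* : ∀ m n .{{_ : NonZero m}} .{{_ : NonZero n}} → rad (m * n) ≤ rad m * rad n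
  rad-* m n = subst₂ _≤_
    (radBelow-stable (m * n) {{m*n≢0 m n}} (suc (m * n)) ≤-refl)
    (cong₂ _*_ (radBelow-stable m (suc (m * n)) (s≤s (m≤m*n m n)))
               (radBelow-stable n (suc (m * n)) (s≤s (m≤n*m n m))))
    (radBelow-* m n (suc (m * n)))

  rad^e∣ : ∀ {n} e → (∀ p → PrimeDivisor n p → p ^ e ∣ n) → rad n ^ e ∣ n
  rad^e∣ {n} e pd⇒p^e∣ = radBelow^e∣ e pd⇒p^e∣ (suc n)

  rad≤ : ∀ n .{{_ : NonZero n}} → rad n ≤ n
  rad≤ n = subst (_≤ n) (*-identityʳ (rad n))
    (∣⇒≤ (rad^e∣ 1 (λ p (_ , p∣n) → subst (_∣ n) (sym (*-identityʳ p)) p∣n)))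

  -- Powerful numbers

  rad*rad≤ : ∀ n .{{_ : NonZero n}} → Powerful n → rad n * rad n ≤ n
  rad*rad≤ n pw = subst (_≤ n) (cong (rad n *_) (*-identityʳ (rad n)))
    (∣⇒≤ (rad^e∣ 2 (λ p (pr , p∣n) → pw p pr p∣n)))

  powerful-* : Powerful m → Powerful n → Powerful (m * n)
  powerful-* {m} {n} pw-m pw-n p pr p∣mn with euclidsLemma m n pr p∣mn
  ... | inj₁ p∣m = ∣-trans (pw-m p pr p∣m) (m∣m*n n)
  ... | inj₂ p∣n = ∣-trans (pw-n p pr p∣n) (n∣m*n m)

  powerful-cofactor : ∀ {k} j → Prime p → Powerful (k * p ^ j) → (p ∣ k → p ^ 2 ∣ k) → Powerful k
  powerful-cofactor {p} {k} j prp pw p-powerful q prq q∣k with q ≟ p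
  ... | yes refl = p-powerful q∣k
  ... | no q≢p = prime^∣*⇒prime^∣ 2 prq q∤p^j (pw q prq (∣-trans q∣k (m∣m*n (p ^ j))))
    where
    q∤p^j : ¬ q ∣ p ^ j
    q∤p^j q∣p^j with prime⇒irreducible prp (prime∣^⇒∣ j prq q∣p^j)
    ... | inj₁ refl = <-irrefl refl (prime>1 prq)
    ... | inj₂ q≡p  = q≢p q≡p

  primeDivisor-of : ∀ n → 1 < n → ∃ (PrimeDivisor n)
  primeDivisor-of n@(suc _) 1<n with factorise n
  ... | record { factors = [] ; isFactorisation = n≡1 } = ⊥-elim (<⇒≢ 1<n (sym n≡1))
  ... | record { factors = p ∷ ps ; isFactorisation = n≡p*ps ; factorsPrime = prp ∷ _ } =
    p , prp , divides (product ps) (trans n≡p*ps (*-comm p _))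

  -- Split off p² or p³ for a prime p ∣ n, according as p³ ∣ n implies p⁴ ∣ n or not.
  powerful-split : ∀ n → 1 < n → Powerful n →
    ∃₂ λ p k → Prime p × Powerful k × (n ≡ k * p ^ 2 ⊎ n ≡ k * p ^ 3)
  powerful-split n 1<n pw with primeDivisor-of n 1<n
  ... | p , prp , p∣n with pw p prp p∣n
  ...   | divides k n≡k*p² with p ∣? k
  ...     | no p∤k = p , k , prp ,
    powerful-cofactor 2 prp (subst Powerful n≡k*p² pw) (λ p∣k → contradiction p∣k p∤k) , inj₁ n≡k*p²
  ...     | yes (divides k₁ k≡k₁*p) with p ∣? k₁
  ...       | yes (divides k₂ k₁≡k₂*p) = p , k , prp ,
    powerful-cofactor 2 prp (subst Powerful n≡k*p² pw) (λ _ → divides k₂ k≡k₂*p²) , inj₁ n≡k*p²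
    where
    k≡k₂*p² : k ≡ k₂ * p ^ 2
    k≡k₂*p² = trans k≡k₁*p (trans (cong (_* p) k₁≡k₂*p) (lemma k₂ p))
      where lemma : ∀ k p → k * p * p ≡ k * (p * (p * 1))
            lemma = solve-∀
  ...       | no p∤k₁ = p , k₁ , prp ,
    powerful-cofactor 3 prp (subst Powerful n≡k₁*p³ pw) (λ p∣k₁ → contradiction p∣k₁ p∤k₁) , inj₂ n≡k₁*p³
    where
    n≡k₁*p³ : n ≡ k₁ * p ^ 3
    n≡k₁*p³ = trans n≡k*p² (trans (cong (_* p ^ 2) k≡k₁*p) (lemma k₁ p))
      where lemma : ∀ k p → k * p * (p * (p * 1)) ≡ k * (p * (p * (p * 1)))
            lemma = solve-∀

  SquareTimesCube : ℕ → Set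
  SquareTimesCube n = ∃₂ λ y z → n ≡ y ^ 2 * z ^ 3

  powerful⇒squareTimesCube : ∀ n .{{_ : NonZero n}} → Powerful n → SquareTimesCube n
  powerful⇒squareTimesCube n = go n (<-wellFounded n)
    where
    go : ∀ n → Acc _<_ n → .{{_ : NonZero n}} → Powerful n → SquareTimesCube n
    go 1 _ _ = 1 , 1 , refl
    go n@(suc (suc _)) (acc rec) pw with powerful-split n (s≤s (s≤s z≤n)) pw
    ... | p , k , prp , pw-k , split = helper split
      where
      k≢0 : ∀ {j} → n ≡ k * p ^ j → NonZero k
      k≢0 {j} n≡ = m*n≢0⇒m≢0 k {p ^ j} {{subst NonZero n≡ _}}
      k<n : ∀ j → n ≡ k * p ^ suc j → k < n
      k<n j n≡ = subst (k <_) (sym n≡) (m<m*n k (p ^ suc j) {{k≢0 {suc j} n≡}}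
                   (^-monoʳ-< p (prime>1 prp) {0} {suc j} (s≤s z≤n)))
      helper : n ≡ k * p ^ 2 ⊎ n ≡ k * p ^ 3 → SquareTimesCube n
      helper (inj₁ n≡) with go k (rec (k<n 1 n≡)) {{k≢0 {2} n≡}} pw-k
      ... | y , z , refl = y * p , z , (begin
        n                         ≡⟨ n≡ ⟩
        y ^ 2 * z ^ 3 * p ^ 2     ≡⟨ *-assoc (y ^ 2) (z ^ 3) (p ^ 2) ⟩
        y ^ 2 * (z ^ 3 * p ^ 2)   ≡⟨ cong (y ^ 2 *_) (*-comm (z ^ 3) (p ^ 2)) ⟩
        y ^ 2 * (p ^ 2 * z ^ 3)   ≡⟨ *-assoc (y ^ 2) (p ^ 2) (z ^ 3) ⟨
        y ^ 2 * p ^ 2 * z ^ 3     ≡⟨ cong (_* z ^ 3) (^-distribʳ-* y p 2) ⟨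
        (y * p) ^ 2 * z ^ 3       ∎)
        where open ≡-Reasoning
      helper (inj₂ n≡) with go k (rec (k<n 2 n≡)) {{k≢0 {3} n≡}} pw-k
      ... | y , z , refl = y , z * p , (begin
        n                         ≡⟨ n≡ ⟩
        y ^ 2 * z ^ 3 * p ^ 3     ≡⟨ *-assoc (y ^ 2) (z ^ 3) (p ^ 3) ⟩
        y ^ 2 * (z ^ 3 * p ^ 3)   ≡⟨ cong (y ^ 2 *_) (^-distribʳ-* z p 3) ⟨
        y ^ 2 * (z * p) ^ 3       ∎)
        where open ≡-Reasoning

  -- Hilbert cubes in W

  UnboundedPowerfulTriples : ℕ → ℕ → Set
  UnboundedPowerfulTriples α β =
    ∀ m → ∃ λ u → m ≤ u × Powerful u × Powerful (u + α) × Powerful (u + α + β)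

  tailSum : (ℕ → ℕ) → ℕ → ℕ
  tailSum a zero    = 0
  tailSum a (suc k) = tailSum a k + a (2 + k)

  tailSum≥ : ∀ {a} → (∀ i → 0 < a i) → ∀ k → k ≤ tailSum a k
  tailSum≥ pos zero    = z≤n
  tailSum≥ {a} pos (suc k) =
    subst (_≤ tailSum a k + a (2 + k)) (+-comm k 1) (+-mono-≤ (tailSum≥ pos k) (pos (2 + k)))

  takeFirstTwo : Bool → Bool → ℕ → Bool
  takeFirstTwo b₀ b₁ zero          = b₀
  takeFirstTwo b₀ b₁ (suc zero)    = b₁
  takeFirstTwo b₀ b₁ (suc (suc _)) = true

  selSum-takeFirstTwo : ∀ a b₀ b₁ k → selSum a (takeFirstTwo b₀ b₁) (2 + k) ≡
    (0 + (if b₀ then a 0 else 0)) + (if b₁ then a 1 else 0) + tailSum a k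
  selSum-takeFirstTwo a b₀ b₁ zero    = sym (+-identityʳ _)
  selSum-takeFirstTwo a b₀ b₁ (suc k) =
    trans (cong (_+ a (2 + k)) (selSum-takeFirstTwo a b₀ b₁ k)) (+-assoc _ (tailSum a k) (a (2 + k)))

  -- In the paper's indexing (a i is a_{i+1}): the points a₀ + ε₁a₁ + ε₂a₂ + (a₃ + ⋯ + a_{k+3}).
  hilbertCube-corner : ∀ a₀ a b₀ b₁ k →
    InHilbertCube a₀ a (a₀ + ((0 + (if b₀ then a 0 else 0)) + (if b₁ then a 1 else 0) + tailSum a (suc k)))
  hilbertCube-corner a₀ a b₀ b₁ k =
    3 + k , takeFirstTwo b₀ b₁ , inj₂ (2 , s≤s (s≤s (s≤s z≤n)) , refl) ,
    cong (a₀ +_) (sym (selSum-takeFirstTwo a b₀ b₁ (suc k)))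

  hilbertCube⇒unboundedPowerfulTriples : ∀ a₀ a → (∀ i → 0 < a i) →
    (∀ x → InHilbertCube a₀ a x → Powerful x) → UnboundedPowerfulTriples (a 0) (a 1)
  hilbertCube⇒unboundedPowerfulTriples a₀ a pos cube⊆W m =
    u , ≤-trans (n≤1+n m) (≤-trans (tailSum≥ pos (suc m)) (m≤n+m _ a₀)) ,
    subst Powerful (cong (a₀ +_) (+-identityˡ r)) (cube⊆W _ (hilbertCube-corner a₀ a false false m)) ,
    subst Powerful (lemma₁ a₀ (a 0) r) (cube⊆W _ (hilbertCube-corner a₀ a true false m)) ,
    subst Powerful (lemma₂ a₀ (a 0) (a 1) r) (cube⊆W _ (hilbertCube-corner a₀ a true true m))
    where
    r = tailSum a (suc m)
    u = a₀ + r
    lemma₁ : ∀ a₀ α r → a₀ + ((0 + α + 0) + r) ≡ a₀ + r + α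
    lemma₁ = solve-∀
    lemma₂ : ∀ a₀ α β r → a₀ + ((0 + α + β) + r) ≡ a₀ + r + α + β
    lemma₂ = solve-∀

  -- The Schinzel–Tijdeman case

  ShiftedCubicPoint : ℕ → ℕ → ℕ → Set
  ShiftedCubicPoint α β u = ∃₂ λ y z → ℤ.+ y ≢ ℤ.0ℤ × ℤ.+ z ≢ ℤ.0ℤ ×
    toℚ ((ℤ.+ y) ℤ.^ 2 ℤ.* (ℤ.+ z) ℤ.^ 3) ≡ evalℚ (shiftedCubic α β) (toℚ (ℤ.+ u))

  powerfulTriple⇒shiftedCubicPoint : ∀ α β u .{{_ : NonZero u}} →
    Powerful u → Powerful (u + α) → Powerful (u + α + β) → ShiftedCubicPoint α β u
  powerfulTriple⇒shiftedCubicPoint α β u pw-u pw-t pw-w =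
    point (powerful⇒squareTimesCube N (powerful-* (powerful-* pw-u pw-t) pw-w))
    where
    N = u * (u + α) * (u + α + β)
    1≤u : 1 ≤ u
    1≤u = >-nonZero⁻¹ u
    instance
      N≢0 : NonZero N
      N≢0 = >-nonZero (*-mono-≤ (*-mono-≤ 1≤u (≤-trans 1≤u (m≤m+n u α)))
                                (≤-trans 1≤u (≤-trans (m≤m+n u α) (m≤m+n (u + α) β))))
    +≢0 : ∀ {m} → m ≢ 0 → ℤ.+ m ≢ ℤ.0ℤ
    +≢0 m≢0 = m≢0 ∘ ℤ.+-injective
    point : SquareTimesCube N → ShiftedCubicPoint α β u
    point (y , z , N≡y²z³) = y , z , +≢0 y≢0 , +≢0 z≢0 , shiftedCubic-solution α β u y z N≡y²z³
      where
      y≢0 : y ≢ 0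
      y≢0 y≡0 = ≢-nonZero⁻¹ N (trans N≡y²z³ (cong (λ v → v ^ 2 * z ^ 3) y≡0))
      z≢0 : z ≢ 0
      z≢0 z≡0 = ≢-nonZero⁻¹ N (trans N≡y²z³ (trans (cong (λ v → y ^ 2 * v ^ 3) z≡0) (*-zeroʳ (y ^ 2))))

  schinzelTijdeman⇒¬unboundedPowerfulTriples : SchinzelTijdeman →
    ∀ α β .{{_ : NonZero α}} .{{_ : NonZero β}} → ¬ UnboundedPowerfulTriples α β
  schinzelTijdeman⇒¬unboundedPowerfulTriples st α β triples =
    let (B , solutions≤B) = st (shiftedCubic α β) (shiftedCubic-simpleZeros α β)
        (u , B<u , pw-u , pw-t , pw-w) = triples (suc B)
        (y , z , y≢0 , z≢0 , solution) =
          powerfulTriple⇒shiftedCubicPoint α β u {{>-nonZero (≤-<-trans z≤n B<u)}} pw-u pw-t pw-w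
    in <⇒≱ B<u (proj₁ (solutions≤B (ℤ.+ u) (ℤ.+ y) (ℤ.+ z) y≢0 z≢0 solution))

  -- The abc case

  gcd-cofactors : ∀ a b .{{_ : NonZero a}} → ∃₂ λ a′ b′ →
    a ≡ gcd a b * a′ × b ≡ gcd a b * b′ × gcd a′ b′ ≡ 1
  gcd-cofactors a b = a′ , b′ , a≡ga′ , b≡gb′ ,
    *-cancelˡ-≡ (gcd a′ b′) 1 g {{g≢0}} (begin
      g * gcd a′ b′          ≡⟨ c*gcd[m,n]≡gcd[cm,cn] g a′ b′ ⟩
      gcd (g * a′) (g * b′)  ≡⟨ cong₂ gcd a≡ga′ b≡gb′ ⟨
      g                      ≡⟨ *-identityʳ g ⟨
      g * 1                  ∎)
    where
    open ≡-Reasoning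
    g = gcd a b
    g≢0 : NonZero g
    g≢0 = ≢-nonZero (gcd[m,n]≢0 a b (inj₁ (≢-nonZero⁻¹ a)))
    a′ = quotient (gcd[m,n]∣m a b)
    b′ = quotient (gcd[m,n]∣n a b)
    a≡ga′ : a ≡ g * a′
    a≡ga′ = m∣n⇒n≡m*quotient (gcd[m,n]∣m a b)
    b≡gb′ : b ≡ g * b′
    b≡gb′ = m∣n⇒n≡m*quotient (gcd[m,n]∣n a b)

  abc-coprime : ABC → ∀ q → 1 ≤ q → ∃ λ K → ∀ a b .{{_ : NonZero a}} .{{_ : NonZero b}} →
    gcd a b ≡ 1 → (a + b) ^ q ≤ K * rad (a * b * (a + b)) ^ suc q
  abc-coprime abc q 1≤q with abc 1 q ≤-refl 1≤q
  ... | K , abc-K = K , bound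
    where
    +≢0 : ∀ x .{{_ : NonZero x}} → ℤ.+ x ≢ ℤ.0ℤ
    +≢0 x = ≢-nonZero⁻¹ x ∘ ℤ.+-injective
    ∣a*b*c∣ : ∀ a b c → ℤ.∣ ℤ.+ a ℤ.* ℤ.+ b ℤ.* ℤ.+ c ∣ ≡ a * b * c
    ∣a*b*c∣ a b c = trans (ℤ.abs-* (ℤ.+ a ℤ.* ℤ.+ b) (ℤ.+ c)) (cong (_* c) (ℤ.abs-* (ℤ.+ a) (ℤ.+ b)))
    bound : ∀ a b .{{_ : NonZero a}} .{{_ : NonZero b}} →
      gcd a b ≡ 1 → (a + b) ^ q ≤ K * rad (a * b * (a + b)) ^ suc q
    bound a b coprime = ≤-trans (^-monoˡ-≤ q (m≤n⊔m (a ⊔ b) (a + b)))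
      (subst₂ (λ r e → (a ⊔ b ⊔ (a + b)) ^ q ≤ K * rad r ^ e) (∣a*b*c∣ a b (a + b)) (+-comm q 1)
        (abc-K (ℤ.+ a) (ℤ.+ b) (ℤ.+ (a + b)) (+≢0 a) (+≢0 b) (+≢0 (a + b)) (sym (ℤ.pos-+ a b))
               (trans (cong (λ d → gcd d (a + b)) coprime) (gcd-zeroˡ (a + b)))))
      where
      instance
        a+b≢0 : NonZero (a + b)
        a+b≢0 = >-nonZero (≤-trans (>-nonZero⁻¹ a) (m≤m+n a b))

  abc-nonCoprime : ABC → ∀ q → 1 ≤ q → ∃ λ K → ∀ a b .{{_ : NonZero a}} .{{_ : NonZero b}} →
    (a + b) ^ q ≤ gcd a b ^ q * (K * rad (a * b * (a + b)) ^ suc q)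
  abc-nonCoprime abc q 1≤q with abc-coprime abc q 1≤q
  ... | K , abc-K = K , bound
    where
    bound : ∀ a b .{{_ : NonZero a}} .{{_ : NonZero b}} →
      (a + b) ^ q ≤ gcd a b ^ q * (K * rad (a * b * (a + b)) ^ suc q)
    bound a b with gcd-cofactors a b
    ... | a′ , b′ , a≡ga′ , b≡gb′ , coprime = begin
      (a + b) ^ q                                  ≡⟨ cong (_^ q) a+b≡g[a′+b′] ⟩
      (g * (a′ + b′)) ^ q                          ≡⟨ ^-distribʳ-* g (a′ + b′) q ⟩
      g ^ q * (a′ + b′) ^ q                        ≤⟨ *-monoʳ-≤ (g ^ q) (abc-K a′ b′ coprime) ⟩
      g ^ q * (K * rad (a′ * b′ * (a′ + b′)) ^ suc q) ≤⟨ *-monoʳ-≤ (g ^ q) (*-monoʳ-≤ K (^-monoˡ-≤ (suc q) rad-cofactors≤)) ⟩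
      g ^ q * (K * rad (a * b * (a + b)) ^ suc q)  ∎
      where
      open ≤-Reasoning
      g = gcd a b
      a+b≡g[a′+b′] : a + b ≡ g * (a′ + b′)
      a+b≡g[a′+b′] = trans (cong₂ _+_ a≡ga′ b≡gb′) (sym (*-distribˡ-+ g a′ b′))
      cofactor≢0 : ∀ {x y} → x ≡ g * y → x ≢ 0 → NonZero y
      cofactor≢0 {x} {y} x≡gy x≢0 =
        ≢-nonZero (λ y≡0 → x≢0 (trans x≡gy (trans (cong (g *_) y≡0) (*-zeroʳ g))))
      instance
        a′≢0 : NonZero a′
        a′≢0 = cofactor≢0 a≡ga′ (≢-nonZero⁻¹ a)
        b′≢0 : NonZero b′
        b′≢0 = cofactor≢0 b≡gb′ (≢-nonZero⁻¹ b)
        a+b≢0 : NonZero (a + b)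
        a+b≢0 = >-nonZero (≤-trans (>-nonZero⁻¹ a) (m≤m+n a b))
        a′+b′≢0 : NonZero (a′ + b′)
        a′+b′≢0 = cofactor≢0 a+b≡g[a′+b′] (≢-nonZero⁻¹ (a + b))
      rad-cofactors≤ : rad (a′ * b′ * (a′ + b′)) ≤ rad (a * b * (a + b))
      rad-cofactors≤ = rad-mono (a′ * b′ * (a′ + b′)) (a * b * (a + b))
        {{m*n≢0 (a′ * b′) (a′ + b′) {{m*n≢0 a′ b′}}}} {{m*n≢0 (a * b) (a + b) {{m*n≢0 a b}}}}
        (λ p (_ , p∣a′b′[a′+b′]) → ∣-trans p∣a′b′[a′+b′]
           (*-pres-∣ (*-pres-∣ (divides g a≡ga′) (divides g b≡gb′)) (divides g a+b≡g[a′+b′])))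

  rad-^ : ∀ m k .{{_ : NonZero m}} → rad (m ^ k) ≤ rad m
  rad-^ m k = rad-mono (m ^ k) m {{m^n≢0 m k}} (λ p (pr , p∣m^k) → prime∣^⇒∣ k pr p∣m^k)

  rad-^*^ : ∀ m n i j .{{_ : NonZero m}} .{{_ : NonZero n}} → rad (m ^ i * n ^ j) ≤ rad m * rad n
  rad-^*^ m n i j = ≤-trans (rad-* (m ^ i) (n ^ j) {{m^n≢0 m i}} {{m^n≢0 n j}})
                            (*-mono-≤ (rad-^ m i) (rad-^ n j))

  rad-square*-≤ : ∀ t D .{{_ : NonZero t}} .{{_ : NonZero D}} → rad (t * t * D) ≤ rad t * D
  rad-square*-≤ t D = ≤-trans (rad-* (t * t) D {{m*n≢0 t t}})
    (*-mono-≤ (rad-mono (t * t) t {{m*n≢0 t t}} (λ p (pr , p∣tt) → [ id , id ]′ (euclidsLemma t t pr p∣tt)))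
              (rad≤ D))

  rad-*-* : ∀ a b c .{{_ : NonZero a}} .{{_ : NonZero b}} .{{_ : NonZero c}} →
            rad (a * b * c) ≤ rad a * rad b * rad c
  rad-*-* a b c = ≤-trans (rad-* (a * b) c {{m*n≢0 a b}}) (*-monoˡ-≤ (rad c) (rad-* a b))

  -- Since s, t, w are powerful, rad(x)² ≤ x bounds the squared radical by s t w D² ≤ 2 t³ D².
  squaredRadical-bound : ∀ k {t s w D C} .{{_ : NonZero t}} .{{_ : NonZero s}} .{{_ : NonZero w}} →
    Powerful t → Powerful s → Powerful w → s ≤ t → w ≤ t + t → t * t * D ≤ C →
    let R = k * (rad t * D) * (rad s * rad w) in t * (R * R) ≤ 2 * (k * k) * (C * C)
  squaredRadical-bound k {t} {s} {w} {D} {C} pw-t pw-s pw-w s≤t w≤2t ttD≤C = begin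
    t * (R * R)
      ≡⟨ cong (t *_) (rearrange k (rad t) D (rad s) (rad w)) ⟩
    t * (k * k * (rad t * rad t) * (D * D) * ((rad s * rad s) * (rad w * rad w)))
      ≤⟨ *-monoʳ-≤ t (*-mono-≤ (*-monoˡ-≤ (D * D) (*-monoʳ-≤ (k * k) (rad*rad≤ t pw-t)))
                                (*-mono-≤ (≤-trans (rad*rad≤ s pw-s) s≤t) (≤-trans (rad*rad≤ w pw-w) w≤2t))) ⟩
    t * (k * k * t * (D * D) * (t * (t + t)))
      ≡⟨ collect k t D ⟩
    2 * (k * k) * ((t * t * D) * (t * t * D))
      ≤⟨ *-monoʳ-≤ (2 * (k * k)) (*-mono-≤ ttD≤C ttD≤C) ⟩
    2 * (k * k) * (C * C) ∎
    where
    open ≤-Reasoning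
    R = k * (rad t * D) * (rad s * rad w)
    rearrange : ∀ k x D y z → k * (x * D) * (y * z) * (k * (x * D) * (y * z)) ≡
                              k * k * (x * x) * (D * D) * ((y * y) * (z * z))
    rearrange = solve-∀
    collect : ∀ k t D → t * (k * k * t * (D * D) * (t * (t + t))) ≡ 2 * (k * k) * ((t * t * D) * (t * t * D))
    collect = solve-∀

  -- Squaring C^q ≤ Y R^{q+1} and substituting t R² ≤ L C² leaves
  -- t^{q+1} ≤ Y² L^{q+1} C² ≤ Y² L^{q+1} H t^q.
  abc-height-bound : ∀ {t C R} Y L H q .{{_ : NonZero t}} .{{_ : NonZero C}} →
    C ^ q ≤ Y * R ^ suc q → t * (R * R) ≤ L * (C * C) → C * C ≤ H * t ^ q →
    t ≤ Y * Y * L ^ suc q * H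
  abc-height-bound {t} {C} {R} Y L H q abc radical height =
    *-cancelʳ-≤ t (Y * Y * L ^ suc q * H) (t ^ q) {{m^n≢0 t q}} (begin
      t * t ^ q                              ≤⟨ t^q+1≤ ⟩
      Y * Y * L ^ suc q * (C * C)            ≤⟨ *-monoʳ-≤ (Y * Y * L ^ suc q) height ⟩
      Y * Y * L ^ suc q * (H * t ^ q)        ≡⟨ *-assoc (Y * Y * L ^ suc q) H (t ^ q) ⟨
      Y * Y * L ^ suc q * H * t ^ q          ∎)
    where
    open ≤-Reasoning
    Cq² = C ^ q * C ^ q
    abc² : Cq² ≤ Y * Y * (R * R) ^ suc q
    abc² = begin
      C ^ q * C ^ q                          ≤⟨ *-mono-≤ abc abc ⟩
      Y * R ^ suc q * (Y * R ^ suc q)        ≡⟨ [m*n]*[o*p]≡[m*o]*[n*p] Y (R ^ suc q) Y (R ^ suc q) ⟩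
      Y * Y * (R ^ suc q * R ^ suc q)        ≡⟨ cong (Y * Y *_) (^-distribʳ-* R R (suc q)) ⟨
      Y * Y * (R * R) ^ suc q                ∎
    t^q+1≤ : t ^ suc q ≤ Y * Y * L ^ suc q * (C * C)
    t^q+1≤ = *-cancelʳ-≤ (t ^ suc q) _ Cq² {{m*n≢0 (C ^ q) (C ^ q) {{m^n≢0 C q}} {{m^n≢0 C q}}}} (begin
      t ^ suc q * Cq²                           ≤⟨ *-monoʳ-≤ (t ^ suc q) abc² ⟩
      t ^ suc q * (Y * Y * (R * R) ^ suc q)     ≡⟨ x∙yz≈y∙xz (t ^ suc q) (Y * Y) ((R * R) ^ suc q) ⟩
      Y * Y * (t ^ suc q * (R * R) ^ suc q)     ≡⟨ cong (Y * Y *_) (^-distribʳ-* t (R * R) (suc q)) ⟨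
      Y * Y * (t * (R * R)) ^ suc q             ≤⟨ *-monoʳ-≤ (Y * Y) (^-monoˡ-≤ (suc q) radical) ⟩
      Y * Y * (L * (C * C)) ^ suc q             ≡⟨ cong (Y * Y *_) (^-distribʳ-* L (C * C) (suc q)) ⟩
      Y * Y * (L ^ suc q * ((C * C) * (C * C) ^ q))
                                                ≡⟨ cong (λ x → Y * Y * (L ^ suc q * (C * C * x))) (^-distribʳ-* C C q) ⟩
      Y * Y * (L ^ suc q * ((C * C) * Cq²))     ≡⟨ reassociate (Y * Y) (L ^ suc q) (C * C) Cq² ⟩
      Y * Y * L ^ suc q * (C * C) * Cq²         ∎)
      where
      reassociate : ∀ a b c d → a * (b * (c * d)) ≡ a * b * c * d
      reassociate = solve-∀

  powerProduct²-height : ∀ {s t w} m n → s ≤ t → w ≤ t + t →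
    (s ^ m * w ^ n) * (s ^ m * w ^ n) ≤ (2 ^ n * 2 ^ n) * t ^ ((m + n) + (m + n))
  powerProduct²-height {s} {t} {w} m n s≤t w≤2t = begin
    (s ^ m * w ^ n) * (s ^ m * w ^ n)
      ≤⟨ *-mono-≤ height height ⟩
    2 ^ n * t ^ (m + n) * (2 ^ n * t ^ (m + n))
      ≡⟨ [m*n]*[o*p]≡[m*o]*[n*p] (2 ^ n) (t ^ (m + n)) (2 ^ n) (t ^ (m + n)) ⟩
    2 ^ n * 2 ^ n * (t ^ (m + n) * t ^ (m + n))
      ≡⟨ cong (2 ^ n * 2 ^ n *_) (^-distribˡ-+-* t (m + n) (m + n)) ⟨
    2 ^ n * 2 ^ n * t ^ ((m + n) + (m + n)) ∎
    where
    open ≤-Reasoning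
    height : s ^ m * w ^ n ≤ 2 ^ n * t ^ (m + n)
    height = begin
      s ^ m * w ^ n              ≤⟨ *-mono-≤ (^-monoˡ-≤ m s≤t) (^-monoˡ-≤ n w≤2t) ⟩
      t ^ m * (t + t) ^ n        ≡⟨ cong (λ x → t ^ m * x ^ n) (cong (t +_) (+-identityʳ t)) ⟨
      t ^ m * (2 * t) ^ n        ≡⟨ cong (t ^ m *_) (^-distribʳ-* 2 t n) ⟩
      t ^ m * (2 ^ n * t ^ n)    ≡⟨ x∙yz≈y∙xz (t ^ m) (2 ^ n) (t ^ n) ⟩
      2 ^ n * (t ^ m * t ^ n)    ≡⟨ cong (2 ^ n *_) (^-distribˡ-+-* t m n) ⟨
      2 ^ n * t ^ (m + n)        ∎

  rad-powerProductTriple : ∀ α β t s w D m n →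
    .{{_ : NonZero α}} .{{_ : NonZero β}} .{{_ : NonZero t}} .{{_ : NonZero s}} .{{_ : NonZero w}} .{{_ : NonZero D}} →
    rad (α ^ m * β ^ n * (t * t * D) * (s ^ m * w ^ n)) ≤ α * β * (rad t * D) * (rad s * rad w)
  rad-powerProductTriple α β t s w D m n =
    ≤-trans (rad-*-* (α ^ m * β ^ n) (t * t * D) (s ^ m * w ^ n)
               {{m*n≢0 (α ^ m) (β ^ n) {{m^n≢0 α m}} {{m^n≢0 β n}}}}
               {{m*n≢0 (t * t) D {{m*n≢0 t t}}}}
               {{m*n≢0 (s ^ m) (w ^ n) {{m^n≢0 s m}} {{m^n≢0 w n}}}})
      (*-mono-≤ (*-mono-≤ (≤-trans (rad-^*^ α β m n) (*-mono-≤ (rad≤ α) (rad≤ β))) (rad-square*-≤ t D))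
                (rad-^*^ s w m n))

  -- ε = 1/(2P), where P = 2α + 2β is the degree of s^{2α} w^{2β}.
  abcExponent : ℕ → ℕ → ℕ
  abcExponent α β = ((α + α) + (β + β)) + ((α + α) + (β + β))

  1≤abcExponent : ∀ α β .{{_ : NonZero α}} → 1 ≤ abcExponent α β
  1≤abcExponent α β = ≤-trans (>-nonZero⁻¹ α)
    (≤-trans (m≤m+n α α) (≤-trans (m≤m+n (α + α) (β + β)) (m≤m+n _ _)))

  abcHeightBound : ℕ → ℕ → ℕ → ℕ
  abcHeightBound α β K =
    (α ^ (α + α) * β ^ (β + β)) ^ abcExponent α β * K * ((α ^ (α + α) * β ^ (β + β)) ^ abcExponent α β * K) *
    (2 * ((α * β) * (α * β))) ^ suc (abcExponent α β) * (2 ^ (β + β) * 2 ^ (β + β))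

  powerfulTriple-abcBound : ∀ α β K .{{_ : NonZero α}} .{{_ : NonZero β}} →
    (∀ a b .{{_ : NonZero a}} .{{_ : NonZero b}} →
       (a + b) ^ abcExponent α β ≤ gcd a b ^ abcExponent α β * (K * rad (a * b * (a + b)) ^ suc (abcExponent α β))) →
    ∀ s → α < s → β < s → Powerful s → Powerful (s + α) → Powerful (s + α + β) →
    s + α ≤ abcHeightBound α β K
  powerfulTriple-abcBound α β K abc-K s α<s β<s pw-s pw-t pw-w =
    bound (powerProduct-modSquare s α β (<⇒≤ A<C))
    where
    n₁ = α + α
    n₂ = β + β
    q = abcExponent α β
    t = s + α
    w = s + α + β
    A = α ^ n₁ * β ^ n₂
    C = s ^ n₁ * w ^ n₂
    s≤t : s ≤ t
    s≤t = m≤m+n s α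
    instance
      s≢0 : NonZero s
      s≢0 = >-nonZero (≤-<-trans z≤n α<s)
      t≢0 : NonZero t
      t≢0 = >-nonZero (<-≤-trans (>-nonZero⁻¹ s) s≤t)
      w≢0 : NonZero w
      w≢0 = >-nonZero (<-≤-trans (>-nonZero⁻¹ t) (m≤m+n t β))
      A≢0 : NonZero A
      A≢0 = m*n≢0 (α ^ n₁) (β ^ n₂) {{m^n≢0 α n₁}} {{m^n≢0 β n₂}}
      C≢0 : NonZero C
      C≢0 = m*n≢0 (s ^ n₁) (w ^ n₂) {{m^n≢0 s n₁}} {{m^n≢0 w n₂}}
    A<C : A < C
    A<C = <-≤-trans (*-monoˡ-< (β ^ n₂) {{m^n≢0 β n₂}} (^-monoˡ-< n₁ {{n₁≢0}} α<s))
                    (*-monoʳ-≤ (s ^ n₁) (^-monoˡ-≤ n₂ (≤-trans (<⇒≤ β<s) (≤-trans s≤t (m≤m+n t β)))))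
      where
      n₁≢0 : NonZero n₁
      n₁≢0 = >-nonZero (≤-trans (>-nonZero⁻¹ α) (m≤m+n α α))
    bound : (∃ λ D → C ≡ A + t * t * D) → t ≤ abcHeightBound α β K
    bound (D , C≡A+ttD) = abc-height-bound {R = R} (A ^ q * K) (2 * ((α * β) * (α * β))) (2 ^ n₂ * 2 ^ n₂) q
      abc-C (squaredRadical-bound (α * β) pw-t pw-s pw-w s≤t w≤2t ttD≤C) (powerProduct²-height n₁ n₂ s≤t w≤2t)
      where
      open ≤-Reasoning
      w≤2t : w ≤ t + t
      w≤2t = +-monoʳ-≤ t (≤-trans (<⇒≤ β<s) s≤t)
      instance
        D≢0 : NonZero D
        D≢0 = ≢-nonZero λ D≡0 → <⇒≢ A<C (begin-equality
          A                  ≡⟨ +-identityʳ A ⟨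
          A + 0              ≡⟨ cong (A +_) (*-zeroʳ (t * t)) ⟨
          A + t * t * 0      ≡⟨ cong (λ d → A + t * t * d) D≡0 ⟨
          A + t * t * D      ≡⟨ C≡A+ttD ⟨
          C                  ∎)
        ttD≢0 : NonZero (t * t * D)
        ttD≢0 = m*n≢0 (t * t) D {{m*n≢0 t t}}
      ttD≤C : t * t * D ≤ C
      ttD≤C = subst (t * t * D ≤_) (sym C≡A+ttD) (m≤n+m (t * t * D) A)
      R = α * β * (rad t * D) * (rad s * rad w)
      abc-C : C ^ q ≤ A ^ q * K * R ^ suc q
      abc-C = begin
        C ^ q
          ≡⟨ cong (_^ q) C≡A+ttD ⟩
        (A + t * t * D) ^ q
          ≤⟨ abc-K A (t * t * D) ⟩
        gcd A (t * t * D) ^ q * (K * rad (A * (t * t * D) * (A + t * t * D)) ^ suc q)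
          ≡⟨ cong (λ c → gcd A (t * t * D) ^ q * (K * rad (A * (t * t * D) * c) ^ suc q)) C≡A+ttD ⟨
        gcd A (t * t * D) ^ q * (K * rad (A * (t * t * D) * C) ^ suc q)
          ≤⟨ *-mono-≤ (^-monoˡ-≤ q (∣⇒≤ (gcd[m,n]∣m A (t * t * D))))
                      (*-monoʳ-≤ K (^-monoˡ-≤ (suc q) (rad-powerProductTriple α β t s w D n₁ n₂))) ⟩
        A ^ q * (K * R ^ suc q)
          ≡⟨ *-assoc (A ^ q) K (R ^ suc q) ⟨
        A ^ q * K * R ^ suc q ∎

  abc⇒¬unboundedPowerfulTriples : ABC →
    ∀ α β .{{_ : NonZero α}} .{{_ : NonZero β}} → ¬ UnboundedPowerfulTriples α β
  abc⇒¬unboundedPowerfulTriples abc α β triples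
    with abc-nonCoprime abc (abcExponent α β) (1≤abcExponent α β)
  ... | K , abc-K with triples (suc (abcHeightBound α β K + α + β))
  ...   | s , M+α+β<s , pw-s , pw-t , pw-w =
    <⇒≱ (<-≤-trans M<s (m≤m+n s α)) (powerfulTriple-abcBound α β K abc-K s α<s β<s pw-s pw-t pw-w)
    where
    M = abcHeightBound α β K
    M<s : M < s
    M<s = ≤-<-trans (≤-trans (m≤m+n M α) (m≤m+n (M + α) β)) M+α+β<s
    α<s : α < s
    α<s = <-≤-trans (s≤s (≤-trans (m≤n+m α M) (m≤m+n (M + α) β))) M+α+β<s
    β<s : β < s
    β<s = <-≤-trans (s≤s (m≤n+m β (M + α))) M+α+β<s

open PowerfulNumbers
  using (UnboundedPowerfulTriples; hilbertCube⇒unboundedPowerfulTriples;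
         schinzelTijdeman⇒¬unboundedPowerfulTriples; abc⇒¬unboundedPowerfulTriples)
open import Defs
open import Data.Nat using (ℕ; _<_; NonZero; >-nonZero)
open import Data.Product using (Σ; _×_; _,_)
open import Data.Sum using (_⊎_; inj₁; inj₂)
open import Level using (Lift; 0ℓ; suc; lift)
open import Relation.Nullary using (¬_)

theorem6 : (Lift (suc 0ℓ) ABC ⊎ SchinzelTijdeman) →
    ¬ (Σ ℕ λ a₀ → Σ (ℕ → ℕ) λ a →
         ((i : ℕ) → 0 < a i) ×
         ((x : ℕ) → InHilbertCube a₀ a x → Powerful x))
theorem6 conjecture (a₀ , a , a>0 , cube⊆W) =
  refute conjecture (hilbertCube⇒unboundedPowerfulTriples a₀ a a>0 cube⊆W)
  where
  instance
    a₁≢0 : NonZero (a 0)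
    a₁≢0 = >-nonZero (a>0 0)
    a₂≢0 : NonZero (a 1)
    a₂≢0 = >-nonZero (a>0 1)
  refute : Lift (suc 0ℓ) ABC ⊎ SchinzelTijdeman → ¬ UnboundedPowerfulTriples (a 0) (a 1)
  refute (inj₁ (lift abc)) = abc⇒¬unboundedPowerfulTriples abc (a 0) (a 1)
  refute (inj₂ st)         = schinzelTijdeman⇒¬unboundedPowerfulTriples st (a 0) (a 1)
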